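{- If $G$ is an infinite graph with finite metric dimension, then $G$ is uniformly locally finite, i.e. there exists a positive integer $M$ such that every vertex of $G$ has degree at most $M$.
   Context: All graphs are simple, connected and locally finite (every vertex has finite degree); they may have infinitely many vertices. $d(u,v)$ denotes the shortest-path distance. A vertex $x$ resolves two vertices $u,v$ if $d(u,x)\neq d(v,x)$. A set $S\subseteq V(G)$ is a resolving set if every pair of distinct vertices of $G$ is resolved by some vertex of $S$. The metric dimension $\beta(G)$ is the minimum cardinality of a resolving set if $G$ has at least one finite resolving set; otherwise $\beta(G)=\infty$. -}

module Defs where

open import Level using (0ℓ)
open import Data.Nat using (ℕ; zero; suc; _≤_)
open import Data.List using (List; length)
open import Data.List.Membership.Propositional using (_∈_)
open import Data.List.Relation.Unary.Any using (Any)
open import Data.List.Relation.Unary.Unique.Propositional using (Unique)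
open import Data.Product using (Σ; ∃; _×_)
open import Function.Bundles using (_⇔_)
open import Relation.Nullary using (¬_)
open import Relation.Binary.PropositionalEquality using (_≡_; _≢_)

record SimpleGraph : Set₁ where
  field
    V     : Set
    Adj   : V → V → Set
    irrefl : ∀ {v} → ¬ Adj v v
    sym    : ∀ {u v} → Adj u v → Adj v u

module _ (G : SimpleGraph) where
  open SimpleGraph G

  data Walk : V → V → ℕ → Set where
    nil  : ∀ {u} → Walk u u zero
    cons : ∀ {u w v n} → Adj u w → Walk w v n → Walk u v (suc n)

  Connected : Set
  Connected = ∀ u v → ∃ λ n → Walk u v n

  LocallyFinite : Set
  LocallyFinite = ∀ v → Σ (List V) λ ns → Unique ns × (∀ u → (u ∈ ns) ⇔ Adj v u)

  Infinite : Set
  Infinite = ¬ (Σ (List V) λ xs → ∀ v → v ∈ xs)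

  IsDist : V → V → ℕ → Set
  IsDist u v n = Walk u v n × (∀ m → Walk u v m → n ≤ m)

  Resolves : V → V → V → Set
  Resolves x u v = ∀ m n → IsDist u x m → IsDist v x n → m ≢ n

  ResolvingSet : List V → Set
  ResolvingSet S = ∀ u v → u ≢ v → Any (λ x → Resolves x u v) S

  FiniteMetricDimension : Set
  FiniteMetricDimension = Σ (List V) ResolvingSet

  degree : LocallyFinite → V → ℕ
  degree lf v = length (Data.Product.proj₁ (lf v))

-- Let S be a resolving set with k elements and v a vertex with distance a_s to
-- each landmark s ∈ S.  Along an edge distances change by at most one, so every
-- neighbour u of v satisfies d(u,s) ∈ {a_s + 1, a_s, a_s - 1}.  Distinct
-- neighbours have distinct distance vectors, hence deg v ≤ 3^k.
--
-- The counting is done by induction on S: the neighbours split into three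
-- layers by their distance to the first landmark s; inside a layer s resolves
-- no pair, so the remaining landmarks separate it and each layer has at most
-- 3^(k-1) elements.  Distances only exist in
-- the double-negation monad, which is harmless since the count is a
-- decidable inequality of natural numbers.
module Submission where

open import Defs
open import Level using (0ℓ)
open import Data.Nat using (ℕ; _≤_; _<_; suc; _+_; _^_; pred; z≤n; s≤s; _≤?_)
open import Data.Nat.Properties
  using (≤-refl; ≤-trans; ≤-antisym; ≤-reflexive; <-cmp; ≮⇒≥; +-mono-≤; +-suc; m≤m+n; m^n>0)
open import Data.Nat.Induction using (<-rec)
open import Data.Product using (∃; _×_; _,_; proj₁; proj₂)
open import Data.Sum using (_⊎_; inj₁; inj₂)
open import Data.Empty using (⊥-elim)
open import Data.List using (List; []; _∷_; length)
open import Data.List.Relation.Unary.All as All using (All; []; _∷_)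
open import Data.List.Relation.Unary.Any using (Any; here; there)
open import Data.List.Relation.Unary.AllPairs as AllPairs using (AllPairs; []; _∷_)
open import Data.List.Relation.Binary.Sublist.Propositional using (_⊆_; []; _∷_; _∷ʳ_; ⊆-trans)
open import Data.List.Relation.Binary.Sublist.Propositional.Properties using (All-resp-⊆)
open import Effect.Monad using (RawMonad)
open import Function.Bundles using (Equivalence)
open import Relation.Binary using (tri<; tri≈; tri>)
open import Relation.Binary.PropositionalEquality using (_≡_; refl; sym; trans; cong)
open import Relation.Nullary using (¬_; yes; no)
open import Relation.Nullary.Decidable using (decidable-stable; ¬¬-excluded-middle)
open import Relation.Nullary.Negation using (¬¬-Monad)

open RawMonad (¬¬-Monad {0ℓ}) using (pure; _>>=_)

module _ {A : Set} where

  record Partition (P Q : A → Set) (xs : List A) : Set where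
    field
      left right   : List A
      left⊆        : left ⊆ xs
      right⊆       : right ⊆ xs
      all-left     : All P left
      all-right    : All Q right
      length-split : length xs ≡ length left + length right

  partition : ∀ {P Q : A → Set} {xs} → All (λ x → P x ⊎ Q x) xs → Partition P Q xs
  partition [] = record
    { left = [] ; right = [] ; left⊆ = [] ; right⊆ = []
    ; all-left = [] ; all-right = [] ; length-split = refl }
  partition {xs = x ∷ _} (inj₁ px ∷ classes) = record
    { left = x ∷ left ; right = right ; left⊆ = refl ∷ left⊆ ; right⊆ = x ∷ʳ right⊆
    ; all-left = px ∷ all-left ; all-right = all-right
    ; length-split = cong suc length-split }
    where open Partition (partition classes)
  partition {xs = x ∷ _} (inj₂ qx ∷ classes) = record
    { left = left ; right = x ∷ right ; left⊆ = x ∷ʳ left⊆ ; right⊆ = refl ∷ right⊆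
    ; all-left = all-left ; all-right = qx ∷ all-right
    ; length-split = trans (cong suc length-split) (sym (+-suc (length left) (length right))) }
    where open Partition (partition classes)

  class-bound : ∀ {P Q : A → Set} {xs} {m n} →
    (∀ {ys} → ys ⊆ xs → All P ys → length ys ≤ m) →
    (∀ {ys} → ys ⊆ xs → All Q ys → length ys ≤ n) →
    All (λ x → P x ⊎ Q x) xs → length xs ≤ m + n
  class-bound bound-P bound-Q classes =
    ≤-trans (≤-reflexive length-split) (+-mono-≤ (bound-P left⊆ all-left) (bound-Q right⊆ all-right))
    where open Partition (partition classes)

  AllPairs-resp-⊆ : ∀ {R : A → A → Set} {xs ys} → ys ⊆ xs → AllPairs R xs → AllPairs R ys
  AllPairs-resp-⊆ []         []       = []
  AllPairs-resp-⊆ (_ ∷ʳ τ)   (_ ∷ rs) = AllPairs-resp-⊆ τ rs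
  AllPairs-resp-⊆ (refl ∷ τ) (r ∷ rs) = All-resp-⊆ τ r ∷ AllPairs-resp-⊆ τ rs

  at-most-one : ∀ {R : A → A → Set} {xs} → (∀ {x y} → ¬ R x y) → AllPairs R xs → length xs ≤ 1
  at-most-one empty []                 = z≤n
  at-most-one empty (_ ∷ [])           = s≤s z≤n
  at-most-one empty ((r ∷ _) ∷ _ ∷ _)  = ⊥-elim (empty r)

Least : (ℕ → Set) → ℕ → Set
Least P m = P m × (∀ k → P k → m ≤ k)

least-witness : ∀ {P : ℕ → Set} n → P n → ¬ ¬ ∃ (Least P)
least-witness {P} = <-rec (λ n → P n → ¬ ¬ ∃ (Least P)) step
  where
  step : ∀ n → (∀ {k} → k < n → P k → ¬ ¬ ∃ (Least P)) → P n → ¬ ¬ ∃ (Least P)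
  step n below pn = ¬¬-excluded-middle {A = ∃ λ k → k < n × P k} >>= λ where
    (yes (k , k<n , pk)) → below k<n pk
    (no none)            → pure (n , pn , λ k pk → ≮⇒≥ (λ k<n → none (k , k<n , pk)))

module _ (G : SimpleGraph) (connected : Connected G) where
  open SimpleGraph G renaming (sym to Adj-sym)

  distance : ∀ u x → ¬ ¬ ∃ (IsDist G u x)
  distance u x = least-witness (proj₁ (connected u x)) (proj₂ (connected u x))

  adjacent-distance : ∀ {v u s a b} → Adj v u → IsDist G v s a → IsDist G u s b →
    b ≡ suc a ⊎ b ≡ a ⊎ b ≡ pred a
  adjacent-distance {a = a} {b} vu (walk-v , least-v) (walk-u , least-u) with <-cmp a b
  ... | tri< a<b _ _ = inj₁ (≤-antisym (least-u _ (cons (Adj-sym vu) walk-v)) a<b)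
  ... | tri≈ _ a≡b _ = inj₂ (inj₁ (sym a≡b))
  ... | tri> _ _ b<a = inj₂ (inj₂ (cong pred (≤-antisym b<a (least-v _ (cons vu walk-u)))))

  InLayers : V → ℕ → V → Set
  InLayers s a u = IsDist G u s (suc a) ⊎ IsDist G u s a ⊎ IsDist G u s (pred a)

  in-layers : ∀ {s u a b} → b ≡ suc a ⊎ b ≡ a ⊎ b ≡ pred a → IsDist G u s b → InLayers s a u
  in-layers (inj₁ refl)        du = inj₁ du
  in-layers (inj₂ (inj₁ refl)) du = inj₂ (inj₁ du)
  in-layers (inj₂ (inj₂ refl)) du = inj₂ (inj₂ du)

  neighbour-layer : ∀ {v u s a} → Adj v u → IsDist G v s a → ¬ ¬ InLayers s a u
  neighbour-layer {u = u} {s} vu dv = distance u s >>= λ where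
    (b , du) → pure (in-layers (adjacent-distance vu dv du) du)

  Separates : List V → List V → Set
  Separates S = AllPairs (λ x y → Any (λ z → Resolves G z x y) S)

  not-resolved-by : ∀ {s S u w c} → IsDist G u s c → IsDist G w s c →
    Any (λ z → Resolves G z u w) (s ∷ S) → Any (λ z → Resolves G z u w) S
  not-resolved-by du dw (here s-resolves) = ⊥-elim (s-resolves _ _ du dw refl)
  not-resolved-by du dw (there resolved)  = resolved

  drop-landmark : ∀ {s S L c} → All (λ u → IsDist G u s c) L →
    Separates (s ∷ S) L → Separates S L
  drop-landmark []         []         = []
  drop-landmark (du ∷ dus) (rs ∷ sep) =
    All.zipWith (λ (dw , r) → not-resolved-by du dw r) (dus , rs) ∷ drop-landmark dus sep

  neighbours-bound : ∀ v S {L} → All (Adj v) L → Separates S L → length L ≤ 3 ^ length S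
  neighbours-bound v []      _   sep = at-most-one (λ ()) sep
  neighbours-bound v (s ∷ S) {L} adj sep = decidable-stable (length L ≤? 3 ^ length (s ∷ S)) do
    (a , dv) ← distance v s
    layers   ← All.mapM 0ℓ ¬¬-Monad (λ vu → neighbour-layer vu dv) adj
    -- 3 ^ length (s ∷ S) unfolds to k + (k + (k + 0))
    pure (≤-trans (three-layers layers) (+-mono-≤ (≤-refl {k}) (+-mono-≤ (≤-refl {k}) (m≤m+n k 0))))
    where
    k : ℕ
    k = 3 ^ length S

    layer-bound : ∀ c {ys} → ys ⊆ L → All (λ u → IsDist G u s c) ys → length ys ≤ k
    layer-bound c τ in-layer =
      neighbours-bound v S (All-resp-⊆ τ adj) (drop-landmark in-layer (AllPairs-resp-⊆ τ sep))

    three-layers : ∀ {a} → All (InLayers s a) L → length L ≤ k + (k + k)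
    three-layers {a} = class-bound (layer-bound (suc a)) λ τ →
      class-bound (λ σ → layer-bound a (⊆-trans σ τ)) (λ σ → layer-bound (pred a) (⊆-trans σ τ))

theorem1 : (G : SimpleGraph) → Connected G → (lf : LocallyFinite G) →
    Infinite G → FiniteMetricDimension G →
    ∃ λ M → 0 < M × (∀ v → degree G lf v ≤ M)
theorem1 G connected lf _ (S , resolving) =
  3 ^ length S , m^n>0 3 (length S) , λ v →
    let (neighbours , unique , neighbour⇔adjacent) = lf v
        adjacent   = All.tabulate (λ {u} → Equivalence.to (neighbour⇔adjacent u))
        separated  = AllPairs.map (λ {x} {y} x≢y → resolving x y x≢y) unique
    in neighbours-bound G connected v S adjacent separated
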